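{- Let $s,d$ be positive integers and $w\ge 3$ an odd integer such that $\gcd(s,d,w)=1$ and $\gcd(3,s)=1$. Then $\varphi(s,d,w)>0$.
   Context: For positive integers $s,d$ and an odd integer $w\ge 3$, let $S(s,d,w)=\{s,\,s+d,\,s+2d,\,\dots,\,s+\frac{w-3}{2}d\}$ and $\varphi(s,d,w)=|\{x\in S(s,d,w):\gcd(x,w)=1\}|$. -}

module Defs where

open import Data.Nat using (ℕ; _+_; _*_; _∸_; _/_; _≟_)
open import Data.Nat.GCD using (gcd)
open import Data.List using (List; map; upTo; filter; length)
open import Relation.Nullary using (Dec)
open import Relation.Binary.PropositionalEquality using (_≡_)

-- S(s,d,w) = { s + i*d : 0 ≤ i ≤ (w-3)/2 }, as a list of (w-1)/2 terms
-- (for w ≥ 3 odd, (w-3)/2 + 1 = (w-1)/2). Since d > 0 the terms are distinct,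
-- so the list represents the set faithfully.
S : ℕ → ℕ → ℕ → List ℕ
S s d w = map (λ i → s + i * d) (upTo ((w ∸ 1) / 2))

φ : ℕ → ℕ → ℕ → ℕ
φ s d w = length (filter (λ x → gcd x w ≟ 1) (S s d w))

module Submission where

-- Call i an admissible index for w when 2i + 3 ≤ w (that is,
-- s + i·d ∈ S(s,d,w)) and s + i·d is coprime to w.  We build one by induction
-- along the prime factorisation w = p·p₂·…·pₖ, bringing in one prime at a time.
--
-- The engine is a lifting step ('lift'): if p is prime, p ∤ gcd(s,d) and
-- s + i·d is coprime to m, then s + i·d or s + (i+m)·d is coprime to p·m.  The
-- second term is congruent to the first modulo m, and p cannot divide both,
-- since it would then divide m·d, hence m or d, each contradicting a hypothesis.
-- Lifting from the trivial modulus 1 gives the one-prime case (index 0, or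
-- index 1 when p ∣ s; then p ≠ 3, so the odd prime p is ≥ 5); in the inductive
-- step 2i + 3 ≤ m and p ≥ 3 give 2(i+m) + 3 ≤ 3m ≤ p·m ('shifted-bound').

open import Defs
open import Data.Nat using (ℕ; _<_; _≤_; _%_)
open import Data.Nat.GCD using (gcd)
open import Relation.Binary.PropositionalEquality using (_≡_)

open import Data.Nat using (suc; _+_; _*_; _∸_; _/_; _≟_; z≤n; s≤s; >-nonZero)
open import Data.Nat.Properties
open import Data.Nat.Divisibility
open import Data.Nat.DivMod using (m*n/n≡m; /-monoˡ-≤)
open import Data.Nat.GCD using (gcd-greatest)
open import Data.Nat.Coprimality using (Coprime; coprime-divisor; gcd≡1⇒coprime; coprime⇒gcd≡1)
open import Data.Nat.Primality
open import Data.Nat.Primality.Factorisation using (factorise)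
open import Data.Nat.ListAction using (product)
open import Data.Nat.Solver using (module +-*-Solver)
open import Data.Product using (Σ; _×_; _,_)
open import Data.Sum using (_⊎_; inj₁; inj₂)
open import Data.List using ([]; _∷_; filter; length)
open import Data.List.Relation.Unary.All using (All; []; _∷_)
open import Data.List.Membership.Propositional using (_∈_)
open import Data.List.Membership.Propositional.Properties using (∈-upTo⁺; ∈-map⁺; ∈-filter⁺)
open import Relation.Nullary using (¬_; yes; no; contradiction)
open import Relation.Binary.PropositionalEquality using (_≢_; refl; sym; trans; subst; subst₂)

open +-*-Solver using (solve; _:+_; _:*_; con; _:=_)

coprime-* : ∀ {x m n} → Coprime x m → Coprime x n → Coprime x (m * n)
coprime-* {x} cm cn (e∣x , e∣mn) = cn (e∣x , coprime-divisor e⊥m e∣mn)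
  where
  e⊥m : Coprime _ _
  e⊥m (f∣e , f∣m) = cm (∣-trans f∣e e∣x , f∣m)

coprime-+* : ∀ {x m} k → Coprime x m → Coprime (x + m * k) m
coprime-+* k c (e∣y , e∣m) = c (∣m+n∣n⇒∣m e∣y (∣m⇒∣m*n k e∣m) , e∣m)
  where
  ∣m+n∣n⇒∣m : ∀ {e a b} → e ∣ a + b → e ∣ b → e ∣ a
  ∣m+n∣n⇒∣m {e} {a} {b} e∣a+b = ∣m+n∣m⇒∣n (subst (e ∣_) (+-comm a b) e∣a+b)

coprime-1 : ∀ x → Coprime x 1
coprime-1 x (_ , e∣1) = ∣1⇒≡1 e∣1

prime∤⇒coprime : ∀ {p x} → Prime p → ¬ p ∣ x → Coprime x p
prime∤⇒coprime pp p∤x (e∣x , e∣p) with prime⇒irreducible pp e∣p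
... | inj₁ e≡1 = e≡1
... | inj₂ refl = contradiction e∣x p∤x

prime∣⇒∤coprime : ∀ {p a b} → Prime p → Coprime a b → p ∣ a → ¬ p ∣ b
prime∣⇒∤coprime pp c p∣a p∣b = ¬prime[1] (subst Prime (c (p∣a , p∣b)) pp)

oddPrime⇒3≤ : ∀ {p} → Prime p → ¬ 2 ∣ p → 3 ≤ p
oddPrime⇒3≤ {0} pp _ = contradiction pp ¬prime[0]
oddPrime⇒3≤ {1} pp _ = contradiction pp ¬prime[1]
oddPrime⇒3≤ {2} _ 2∤2 = contradiction ∣-refl 2∤2
oddPrime⇒3≤ {suc (suc (suc _))} _ _ = s≤s (s≤s (s≤s z≤n))

odd≢3⇒5≤ : ∀ {n} → 3 ≤ n → ¬ 2 ∣ n → n ≢ 3 → 5 ≤ n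
odd≢3⇒5≤ {0} () _ _
odd≢3⇒5≤ {1} (s≤s ()) _ _
odd≢3⇒5≤ {2} (s≤s (s≤s ())) _ _
odd≢3⇒5≤ {3} _ _ n≢3 = contradiction refl n≢3
odd≢3⇒5≤ {4} _ 2∤4 _ = contradiction (divides 2 refl) 2∤4
odd≢3⇒5≤ {suc (suc (suc (suc (suc _))))} _ _ _ = s≤s (s≤s (s≤s (s≤s (s≤s z≤n))))

-- An admissible index for w: the term s + i·d lies in S(s,d,w) and is coprime to w.
Admissible : ℕ → ℕ → ℕ → Set
Admissible s d w = Σ ℕ λ i → 2 * i + 3 ≤ w × Coprime (s + i * d) w

lift : ∀ {p m} s d i → Prime p → ¬ p ∣ gcd s d → Coprime (s + i * d) m →
       Coprime (s + i * d) (p * m) ⊎ (p ∣ s + i * d × Coprime (s + (i + m) * d) (p * m))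
lift {p} {m} s d i pp p∤g c with p ∣? s + i * d
... | no p∤x = inj₁ (coprime-* (prime∤⇒coprime pp p∤x) c)
... | yes p∣x = inj₂ (p∣x , coprime-* (prime∤⇒coprime pp p∤y) y⊥m)
  where
  shift : s + (i + m) * d ≡ (s + i * d) + m * d
  shift = solve 4 (λ s i m d → s :+ (i :+ m) :* d := (s :+ i :* d) :+ m :* d) refl s i m d

  -- the shifted term is congruent to s + i·d modulo m
  y⊥m : Coprime (s + (i + m) * d) m
  y⊥m = subst (λ y → Coprime y m) (sym shift) (coprime-+* d c)

  p∣s : p ∣ d → p ∣ s
  p∣s p∣d = ∣m+n∣m⇒∣n (subst (p ∣_) (+-comm s (i * d)) p∣x) (∣n⇒∣m*n i p∣d)

  -- p dividing both terms would divide m·d, hence m (against s + i·d ⊥ m) or d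
  p∤y : ¬ p ∣ s + (i + m) * d
  p∤y p∣y with euclidsLemma m d pp (∣m+n∣m⇒∣n (subst (p ∣_) shift p∣y) p∣x)
  ... | inj₁ p∣m = prime∣⇒∤coprime pp c p∣x p∣m
  ... | inj₂ p∣d = p∤g (gcd-greatest (p∣s p∣d) p∣d)

shifted-bound : ∀ i m {p} → 2 * i + 3 ≤ m → 3 ≤ p → 2 * (i + m) + 3 ≤ p * m
shifted-bound i m {p} bound 3≤p = begin
  2 * (i + m) + 3     ≡⟨ solve 2 (λ i m → con 2 :* (i :+ m) :+ con 3 := (con 2 :* i :+ con 3) :+ con 2 :* m) refl i m ⟩
  (2 * i + 3) + 2 * m ≤⟨ +-monoˡ-≤ (2 * m) bound ⟩
  m + 2 * m           ≡⟨ solve 1 (λ m → m :+ con 2 :* m := con 3 :* m) refl m ⟩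
  3 * m               ≤⟨ *-monoˡ-≤ m 3≤p ⟩
  p * m               ∎
  where open ≤-Reasoning

oddPrimeFactor⇒3≤ : ∀ {p} m → Prime p → ¬ 2 ∣ p * m → 3 ≤ p
oddPrimeFactor⇒3≤ m pp 2∤w = oddPrime⇒3≤ pp (λ 2∣p → 2∤w (∣-trans 2∣p (m∣m*n m)))

admissible-product : ∀ s d → ¬ 3 ∣ s → ∀ p ps → All Prime (p ∷ ps) →
  ¬ 2 ∣ product (p ∷ ps) → Coprime (gcd s d) (product (p ∷ ps)) →
  Admissible s d (product (p ∷ ps))
admissible-product s d 3∤s p [] (pp ∷ []) 2∤w g⊥w =
  start (lift s d 0 pp (λ p∣g → prime∣⇒∤coprime pp g⊥w p∣g (m∣m*n 1)) (coprime-1 s+0))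
  where
  s+0 : ℕ
  s+0 = s + 0 * d

  3≤w : 3 ≤ p * 1
  3≤w = subst (3 ≤_) (sym (*-identityʳ p)) (oddPrimeFactor⇒3≤ 1 pp 2∤w)

  -- index 1 is only needed when p ∣ s, and then p = 3 would contradict 3 ∤ s
  start : Coprime s+0 (p * 1) ⊎ (p ∣ s+0 × Coprime (s + (0 + 1) * d) (p * 1)) →
          Admissible s d (p * 1)
  start (inj₁ c) = 0 , 3≤w , c
  start (inj₂ (p∣s+0 , c)) = 1 , odd≢3⇒5≤ 3≤w 2∤w w≢3 , c
    where
    w≢3 : p * 1 ≢ 3
    w≢3 w≡3 = 3∤s (subst₂ _∣_ w≡3 (+-identityʳ s) (subst (_∣ s + 0) (sym (*-identityʳ p)) p∣s+0))
admissible-product s d 3∤s p ps@(q ∷ qs) (pp ∷ psPrime) 2∤w g⊥w =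
  extend (admissible-product s d 3∤s q qs psPrime
           (λ 2∣m → 2∤w (∣-trans 2∣m (n∣m*n p)))
           (λ (e∣g , e∣m) → g⊥w (e∣g , ∣-trans e∣m (n∣m*n p))))
  where
  m : ℕ
  m = product ps

  p∤g : ¬ p ∣ gcd s d
  p∤g p∣g = prime∣⇒∤coprime pp g⊥w p∣g (m∣m*n m)

  extend : Admissible s d m → Admissible s d (p * m)
  extend (i , bound , c) with lift s d i pp p∤g c
  ... | inj₁ c′ = i , ≤-trans bound (m≤n*m m p {{prime⇒nonZero pp}}) , c′
  ... | inj₂ (_ , c′) = i + m , shifted-bound i m bound (oddPrimeFactor⇒3≤ m pp 2∤w) , c′

admissible : ∀ s d w → ¬ 3 ∣ s → ¬ 2 ∣ w → 3 ≤ w → Coprime (gcd s d) w → Admissible s d w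
admissible s d w 3∤s 2∤w 3≤w g⊥w with factorise w {{>-nonZero (≤-trans (s≤s z≤n) 3≤w)}}
... | record { factors = [] ; isFactorisation = refl } = contradiction 3≤w λ { (s≤s ()) }
... | record { factors = p ∷ ps ; isFactorisation = refl ; factorsPrime = primes } =
  admissible-product s d 3∤s p ps primes 2∤w g⊥w

index-in-range : ∀ i w → 2 * i + 3 ≤ w → i < (w ∸ 1) / 2
index-in-range i w bound = begin-strict
  i                 <⟨ n<1+n i ⟩
  suc i             ≡⟨ sym (m*n/n≡m (suc i) 2) ⟩
  suc i * 2 / 2     ≤⟨ /-monoˡ-≤ 2 2+2i≤w∸1 ⟩
  (w ∸ 1) / 2       ∎
  where
  open ≤-Reasoning
  2+2i≤w∸1 : suc i * 2 ≤ w ∸ 1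
  2+2i≤w∸1 = begin
    suc i * 2       ≡⟨ solve 1 (λ i → (con 1 :+ i) :* con 2 := con 2 :* i :+ con 2) refl i ⟩
    2 * i + 2       ≡⟨ +-∸-assoc (2 * i) {3} {1} (s≤s z≤n) ⟨
    2 * i + 3 ∸ 1   ≤⟨ ∸-monoˡ-≤ 1 bound ⟩
    w ∸ 1           ∎

admissible⇒φ-positive : ∀ s d w → Admissible s d w → 0 < φ s d w
admissible⇒φ-positive s d w (i , bound , c) = nonempty term∈coprimeTerms
  where
  term∈coprimeTerms : s + i * d ∈ filter (λ x → gcd x w ≟ 1) (S s d w)
  term∈coprimeTerms = ∈-filter⁺ (λ x → gcd x w ≟ 1)
    (∈-map⁺ (λ j → s + j * d) (∈-upTo⁺ (index-in-range i w bound))) (coprime⇒gcd≡1 c)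

  nonempty : ∀ {x : ℕ} {xs} → x ∈ xs → 0 < length xs
  nonempty {xs = _ ∷ _} _ = s≤s z≤n

lemma4p8 : (s d w : ℕ) → 0 < s → 0 < d → 3 ≤ w → w % 2 ≡ 1 →
    gcd (gcd s d) w ≡ 1 → gcd 3 s ≡ 1 → 0 < φ s d w
lemma4p8 s d w _ _ 3≤w w-odd gcd[s,d,w]≡1 gcd[3,s]≡1 =
  admissible⇒φ-positive s d w (admissible s d w 3∤s 2∤w 3≤w (gcd≡1⇒coprime gcd[s,d,w]≡1))
  where
  3∤s : ¬ 3 ∣ s
  3∤s 3∣s = contradiction (gcd≡1⇒coprime gcd[3,s]≡1 (∣-refl , 3∣s)) λ ()
  2∤w : ¬ 2 ∣ w
  2∤w 2∣w = contradiction (trans (sym w-odd) (n∣m⇒m%n≡0 w 2 2∣w)) λ ()
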